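{- Let $\varphi$ be a bidimensional square morphism of size $2$ over the alphabet $\{0,1\}$ that is prolongable on $1$, and let $\varphi^\omega(1)$ be its fixed point beginning with $1$. Then $\varphi^\omega(1)$ is strongly uniformly recurrent along all directions (SURD) if and only if either $\varphi(0)_{(0,0)}=1$ or $\varphi(1)_{(i,j)}=1$ for all $(i,j)\in\{0,1\}^2$.
   Context: $\mathbb{N}=\{0,1,\ldots\}$. A bidimensional infinite word over $A$ is a map $w\colon\mathbb{N}^2\to A$. A bidimensional square morphism of size $s$ is a map $\varphi$ sending each letter $a\in A$ to a block $\varphi(a)\colon\{0,\ldots,s-1\}^2\to A$; we write $\varphi(a)_{\mathbf{i}}$ for $\varphi(a)(\mathbf{i})$. Its iterates are $\varphi^n(a)\colon\{0,\ldots,s^n-1\}^2\to A$, $\varphi^n(a)(\mathbf{i})=\varphi\big(\varphi^{n-1}(a)(\mathbf{q})\big)(\mathbf{r})$, where $\mathbf{i}=s\mathbf{q}+\mathbf{r}$ is componentwise Euclidean division ($\mathbf{r}\in\{0,\ldots,s-1\}^2$). $\varphi$ is prolongable on $a$ if $\varphi(a)_{(0,0)}=a$; then $\varphi^n(a)$ is a prefix of $\varphi^{n+1}(a)$ and the limit word $\varphi^\omega(a)\colon\mathbb{N}^2\to A$ is the fixed point beginning with $a$. For a bidimensional word $w$, a size $\mathbf{s}=(s_1,s_2)$ and a direction $\mathbf{q}\in\mathbb{N}^2$ (coprime nonnegative entries), $w_{\mathbf{q},\mathbf{s}}$ is the one-dimensional word whose $\ell$-th letter is the block $\mathbf{i}\mapsto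 w(\mathbf{i}+\ell\mathbf{q})$, $\mathbf{i}\in\{0,\ldots,s_1-1\}\times\{0,\ldots,s_2-1\}$. $w$ is SURD if for each $\mathbf{s}$ there is $b\in\mathbb{N}$ such that for every direction $\mathbf{q}$, every length-$b$ factor of $w_{\mathbf{q},\mathbf{s}}$ contains the letter $w_{\mathbf{q},\mathbf{s}}(0)$. -}

module Defs where

open import Data.Nat using (ℕ; zero; suc; _+_; _*_; _<_)
open import Data.Nat.DivMod using (_/_; _mod_)
open import Data.Nat.Coprimality using (Coprime)
open import Data.Fin using (Fin; toℕ)
open import Data.Product using (∃-syntax; _×_)
open import Relation.Binary.PropositionalEquality using (_≡_)

A₂ : Set
A₂ = Fin 2

𝟘 𝟙 : A₂
𝟘 = Data.Fin.zero
𝟙 = Data.Fin.suc Data.Fin.zero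

-- A bidimensional square morphism of size 2 over an alphabet A:
-- φ a i j  is  φ(a)_{(i,j)} for (i,j) ∈ {0,1}².
SqMorphism2 : Set → Set
SqMorphism2 A = A → Fin 2 → Fin 2 → A

-- Iterates φⁿ(a), extended to all of ℕ² (only meaningful on {0..2ⁿ-1}²):
-- φⁿ(a)(i) = φ(φⁿ⁻¹(a)(q))(r) with i = 2q + r.
iter : {A : Set} → SqMorphism2 A → ℕ → A → ℕ → ℕ → A
iter φ zero    a i j = a
iter φ (suc n) a i j = φ (iter φ n a (i / 2) (j / 2)) (i mod 2) (j mod 2)

Prolongable : {A : Set} → SqMorphism2 A → A → Set
Prolongable φ a = φ a Data.Fin.zero Data.Fin.zero ≡ a

-- The limit word φ^ω(a) : ℕ² → A.  Since 2^(i+j+1) > i, j, position (i,j)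
-- lies inside φ^(i+j+1)(a); when φ is prolongable on a this is the fixed point.
fixedPoint : {A : Set} → SqMorphism2 A → A → ℕ → ℕ → A
fixedPoint φ a i j = iter φ (suc (i + j)) a i j

-- w_{q,s}: the one-dimensional word over blocks of size s₁ × s₂ read along q.
slice : {A : Set} → (ℕ → ℕ → A) → (s₁ s₂ q₁ q₂ : ℕ) → ℕ → Fin s₁ → Fin s₂ → A
slice w s₁ s₂ q₁ q₂ ℓ i j = w (toℕ i + ℓ * q₁) (toℕ j + ℓ * q₂)

BlockEq : {A : Set} {s₁ s₂ : ℕ} → (Fin s₁ → Fin s₂ → A) → (Fin s₁ → Fin s₂ → A) → Set
BlockEq x y = ∀ i j → x i j ≡ y i j

SURD : {A : Set} → (ℕ → ℕ → A) → Set
SURD w = ∀ (s₁ s₂ : ℕ) → ∃[ b ] (∀ (q₁ q₂ : ℕ) → Coprime q₁ q₂ →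
           ∀ (m : ℕ) → ∃[ k ] (k < b ×
             BlockEq (slice w s₁ s₂ q₁ q₂ (m + k)) (slice w s₁ s₂ q₁ q₂ 0)))

-- If φ(0) and φ(1) both begin with 1, then φ^{n+1}(c) agrees with φ^n(1) on [0,2^n)² for every
-- letter c, so the n × n blocks of the fixed point repeat with period 2^{n+1}; if φ(1) is all 1s the
-- fixed point is constant.  Conversely, let φ(c)_{(0,0)} = c for both letters and φ(1)_d = 0 for
-- some d ∈ {0,1}², and write g_d(c) = φ(c)_d.  The letter of φ^M(a) at x·d is g_d^{s(x)}(a), where
-- s(x) is the digit sum of the last M binary digits of x; as j and 2^N − 1 − j have complementary
-- N-digit expansions, s((j+1)(2^N − 1)) = N for j < 2^N.  Completing d to a basis (d, e) of ℤ²,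
-- the primitive direction q = (2^N − 1)d + 2^{2N}(2^{N+1} − 1)e therefore carries the letter
-- g_d^N(g_e^{N+1}(1)) at all of q, 2q, …, 2^N q, and for N odd (after swapping d and e when g_e is
-- constantly 0) this letter is 0, whereas the fixed point starts with 1.

module Submission where

open import Data.Empty using (⊥-elim)
open import Data.Fin using (Fin; toℕ)
open import Data.Fin.Patterns using (0F; 1F)
open import Data.Fin.Properties using (fromℕ<-cong; toℕ<n) renaming (0≢1+n to 0F≢1+i)
open import Data.Nat using (ℕ; zero; suc; pred; _+_; _*_; _^_; _∸_; _≤_; _<_; z≤n; s≤s)
open import Data.Nat.Coprimality using (Coprime; coprime-+) renaming (sym to coprime-sym)
open import Data.Nat.Divisibility using (_∣_; divides-refl; ∣1⇒≡1; ∣m+n∣m⇒∣n; ∣m⇒∣m*n)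
open import Data.Nat.DivMod
open import Data.Nat.Properties
open import Data.Nat.Tactic.RingSolver using (solve-∀)
open import Data.Product using (_×_; _,_; ∃-syntax)
open import Data.Sum using (_⊎_; inj₁; inj₂)
open import Function.Bundles using (_⇔_; mk⇔)
open import Relation.Binary.PropositionalEquality
open import Relation.Nullary using (¬_)

open import Defs
open import Algebra.Properties.CommutativeSemigroup *-commutativeSemigroup using (x∙yz≈y∙xz)
open import Function.Endo.Propositional A₂ using (Endo; ^-homo) renaming (_^_ to _^ᶠ_)

n<2^n : ∀ n → n < 2 ^ n
n<2^n zero    = s≤s z≤n
n<2^n (suc n) = +-mono-≤ (m^n>0 2 n) (≤-trans (n<2^n n) (m≤m+n (2 ^ n) 0))

m*n+o<m*p : ∀ {m n o p} → n < p → o < m → m * n + o < m * p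
m*n+o<m*p {m} {n} {o} {p} n<p o<m = begin-strict
  m * n + o  <⟨ +-monoʳ-< (m * n) o<m ⟩
  m * n + m  ≡⟨ +-comm (m * n) m ⟩
  m + m * n  ≡⟨ *-suc m n ⟨
  m * suc n  ≤⟨ *-monoʳ-≤ m n<p ⟩
  m * p      ∎
  where open ≤-Reasoning

2^0*n+0≡n : ∀ n → 2 ^ 0 * n + 0 ≡ n
2^0*n+0≡n n = trans (+-identityʳ (1 * n)) (*-identityˡ n)

half-< : ∀ {m n} → m < 2 ^ suc n → m / 2 < 2 ^ n
half-< {m} {n} m<2^[1+n] = m<n*o⇒m/o<n (subst (m <_) (*-comm 2 (2 ^ n)) m<2^[1+n])

halve-+*2 : ∀ m n → (m + n * 2) / 2 ≡ m / 2 + n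
halve-+*2 m n = trans (+-distrib-/-∣ʳ m (divides-refl n)) (cong (m / 2 +_) (m*n/n≡m n 2))

mod2-+*2 : ∀ m n → (m + n * 2) mod 2 ≡ m mod 2
mod2-+*2 m n = fromℕ<-cong _ _ ([m+kn]%n≡m%n m n 2) _ _

2^[1+k]*n+m≡m+2^k*n*2 : ∀ k m n → 2 ^ suc k * n + m ≡ m + 2 ^ k * n * 2
2^[1+k]*n+m≡m+2^k*n*2 k m n =
  trans (+-comm _ m) (cong (m +_) (trans (*-assoc 2 (2 ^ k) n) (*-comm 2 (2 ^ k * n))))

halve-2^[1+k]*n+m : ∀ k m n → (2 ^ suc k * n + m) / 2 ≡ 2 ^ k * n + m / 2
halve-2^[1+k]*n+m k m n = begin
  (2 ^ suc k * n + m) / 2  ≡⟨ /-congˡ (2^[1+k]*n+m≡m+2^k*n*2 k m n) ⟩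
  (m + 2 ^ k * n * 2) / 2  ≡⟨ halve-+*2 m (2 ^ k * n) ⟩
  m / 2 + 2 ^ k * n        ≡⟨ +-comm (m / 2) _ ⟩
  2 ^ k * n + m / 2        ∎
  where open ≡-Reasoning

mod2-2^[1+k]*n+m : ∀ k m n → (2 ^ suc k * n + m) mod 2 ≡ m mod 2
mod2-2^[1+k]*n+m k m n =
  trans (cong (_mod 2) (2^[1+k]*n+m≡m+2^k*n*2 k m n)) (mod2-+*2 m (2 ^ k * n))

mersenne-multiple : ∀ {j P} → suc j ≤ P → suc j * pred P ≡ P * j + (P ∸ suc j)
mersenne-multiple {j} {P} le =
  subst (λ P → suc j * pred P ≡ P * j + (P ∸ suc j)) (m+[n∸m]≡n le) (expanded (P ∸ suc j))
  where
  expand : ∀ j t → (1 + j) * (j + t) ≡ (1 + j + t) * j + t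
  expand = solve-∀
  expanded : ∀ t → suc j * pred (suc j + t) ≡ (suc j + t) * j + (suc j + t ∸ suc j)
  expanded t rewrite m+n∸m≡n (suc j) t = expand j t

mersenne-multiple-< : ∀ j N → suc j ≤ 2 ^ N → suc j * pred (2 ^ N) < 2 ^ (N + N)
mersenne-multiple-< j N le = begin-strict
  suc j * pred (2 ^ N)          ≡⟨ mersenne-multiple le ⟩
  2 ^ N * j + (2 ^ N ∸ suc j)   <⟨ m*n+o<m*p le (∸-monoʳ-< (s≤s z≤n) le) ⟩
  2 ^ N * 2 ^ N                 ≡⟨ ^-distribˡ-+-* 2 N N ⟨
  2 ^ (N + N)                   ∎
  where open ≤-Reasoning

mersenne-coprime : ∀ N → Coprime (pred (2 ^ N)) (2 ^ (N + N) * pred (2 ^ suc N))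
mersenne-coprime N =
  subst₂ (λ a b → Coprime X (a * b)) (sym 2^[N+N]≡[1+X]²) (sym 2^[1+N]-1≡1+2X) coprime-X
  where
  X = pred (2 ^ N)
  2^N≡1+X : 2 ^ N ≡ suc X
  2^N≡1+X = sym (suc-pred (2 ^ N) {{m^n≢0 2 N}})
  2^[N+N]≡[1+X]² : 2 ^ (N + N) ≡ suc X * suc X
  2^[N+N]≡[1+X]² = trans (^-distribˡ-+-* 2 N N) (cong₂ _*_ 2^N≡1+X 2^N≡1+X)
  2^[1+N]-1≡1+2X : pred (2 ^ suc N) ≡ suc (2 * X)
  2^[1+N]-1≡1+2X = trans (cong (λ p → pred (2 * p)) 2^N≡1+X) (+-suc X (X + 0))
  expand : ∀ X → (1 + X) * (1 + X) * (1 + 2 * X) ≡ X * (2 * X * X + 5 * X + 4) + 1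
  expand = solve-∀
  coprime-X : Coprime X (suc X * suc X * suc (2 * X))
  coprime-X {i} (i∣X , i∣rhs) =
    ∣1⇒≡1 (∣m+n∣m⇒∣n (subst (i ∣_) (expand X) i∣rhs) (∣m⇒∣m*n _ i∣X))

multiple-within : ∀ {P} → 0 < P → ∀ m → ∃[ k ] k < P × ∃[ t ] m + k ≡ t * P
multiple-within {suc p} _ zero = 0 , s≤s z≤n , 0 , refl
multiple-within {suc p} P>0 (suc m) with multiple-within P>0 m
... | suc k , s≤s k<p , t , m+1+k≡tP = k , m<n⇒m<1+n k<p , t , trans (sym (+-suc m k)) m+1+k≡tP
... | zero  , _       , t , m+0≡tP  = p , ≤-refl , suc t , cong suc (begin
  m + p              ≡⟨ cong (_+ p) (trans (sym (+-identityʳ m)) m+0≡tP) ⟩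
  t * suc p + p      ≡⟨ +-comm (t * suc p) p ⟩
  p + t * suc p      ∎)
  where open ≡-Reasoning

popCount : ℕ → ℕ → ℕ
popCount zero    x = 0
popCount (suc N) x = toℕ (x mod 2) + popCount N (x / 2)

popCount-digit : ∀ N (r : Fin 2) q → popCount (suc N) (toℕ r + q * 2) ≡ toℕ r + popCount N q
popCount-digit N r q rewrite halve-+*2 (toℕ r) q | mod2-+*2 (toℕ r) q with r
... | 0F = refl
... | 1F = refl

popCount-split : ∀ M L x z → z < 2 ^ M → popCount (M + L) (2 ^ M * x + z) ≡ popCount M z + popCount L x
popCount-split zero    L x .0 (s≤s z≤n) = cong (popCount L) (2^0*n+0≡n x)
popCount-split (suc M) L x z z<2^[1+M]
  rewrite halve-2^[1+k]*n+m M z x | mod2-2^[1+k]*n+m M z x =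
  trans (cong (toℕ (z mod 2) +_) (popCount-split M L x (z / 2) (half-< {n = M} z<2^[1+M])))
        (sym (+-assoc (toℕ (z mod 2)) _ _))

popCount-complement : ∀ N j k → suc (j + k) ≡ 2 ^ N → popCount N j + popCount N k ≡ N
popCount-complement zero    j k _ = refl
popCount-complement (suc N) j k j+k+1≡2^[1+N] with j divMod 2 | k divMod 2
... | result a r refl | result b s refl
  rewrite popCount-digit N r a | popCount-digit N s b = digits r s j+k+1≡2^[1+N]
  where
  digits : ∀ r s → suc (toℕ r + a * 2 + (toℕ s + b * 2)) ≡ 2 * 2 ^ N →
           toℕ r + popCount N a + (toℕ s + popCount N b) ≡ suc N
  digits 0F 0F eq = ⊥-elim (even≢odd (2 ^ N) (a + b) (trans (sym eq) (cong suc (rearrange a b))))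
    where
    rearrange : ∀ a b → a * 2 + b * 2 ≡ 2 * (a + b)
    rearrange = solve-∀
  digits 1F 1F eq = ⊥-elim (even≢odd (2 ^ N) (suc (a + b)) (trans (sym eq) (rearrange a b)))
    where
    rearrange : ∀ a b → 1 + (1 + a * 2 + (1 + b * 2)) ≡ 1 + 2 * (1 + a + b)
    rearrange = solve-∀
  digits 0F 1F eq = trans (+-suc (popCount N a) _) (cong suc (popCount-complement N a b halves))
    where
    rearrange : ∀ a b → 1 + (a * 2 + (1 + b * 2)) ≡ 2 * (1 + a + b)
    rearrange = solve-∀
    halves : suc (a + b) ≡ 2 ^ N
    halves = *-cancelˡ-≡ _ _ 2 (trans (sym (rearrange a b)) eq)
  digits 1F 0F eq = cong suc (popCount-complement N a b halves)
    where
    rearrange : ∀ a b → 1 + (1 + a * 2 + b * 2) ≡ 2 * (1 + a + b)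
    rearrange = solve-∀
    halves : suc (a + b) ≡ 2 ^ N
    halves = *-cancelˡ-≡ _ _ 2 (trans (sym (rearrange a b)) eq)

popCount-mersenne-multiple : ∀ j N → suc j ≤ 2 ^ N → popCount (N + N) (suc j * pred (2 ^ N)) ≡ N
popCount-mersenne-multiple j N le = begin
  popCount (N + N) (suc j * pred (2 ^ N))             ≡⟨ cong (popCount (N + N)) (mersenne-multiple le) ⟩
  popCount (N + N) (2 ^ N * j + k)                    ≡⟨ popCount-split N N j k k<2^N ⟩
  popCount N k + popCount N j                         ≡⟨ popCount-complement N k j k+j+1≡2^N ⟩
  N                                                   ∎
  where
  open ≡-Reasoning
  k = 2 ^ N ∸ suc j
  k<2^N : k < 2 ^ N
  k<2^N = ∸-monoʳ-< (s≤s z≤n) le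
  k+j+1≡2^N : suc (k + j) ≡ 2 ^ N
  k+j+1≡2^N = trans (sym (+-suc k j)) (m∸n+n≡m le)

infixl 7 _·_

_·_ : Fin 2 → ℕ → ℕ
0F · x = 0
1F · x = x

·-≤ : ∀ d x → d · x ≤ x
·-≤ 0F x = z≤n
·-≤ 1F x = ≤-refl

·-halve : ∀ d x → (d · x) / 2 ≡ d · (x / 2)
·-halve 0F x = refl
·-halve 1F x = refl

*-· : ∀ m d x → m * (d · x) ≡ d · (m * x)
*-· m 0F x = *-zeroʳ m
*-· m 1F x = refl

line-position : ∀ m d e x z y → m * (d · x + e · (z * y)) ≡ z * (e · (m * y)) + d · (m * x)
line-position m d e x z y = begin
  m * (d · x + e · (z * y))          ≡⟨ *-distribˡ-+ m (d · x) _ ⟩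
  m * (d · x) + m * (e · (z * y))    ≡⟨ +-comm (m * (d · x)) _ ⟩
  m * (e · (z * y)) + m * (d · x)    ≡⟨ cong₂ _+_ (*-· m e (z * y)) (*-· m d x) ⟩
  e · (m * (z * y)) + d · (m * x)    ≡⟨ cong (λ n → e · n + d · (m * x)) (x∙yz≈y∙xz m z y) ⟩
  e · (z * (m * y)) + d · (m * x)    ≡⟨ cong (_+ d · (m * x)) (*-· z e (m * y)) ⟨
  z * (e · (m * y)) + d · (m * x)    ∎
  where open ≡-Reasoning

-- The pairs of 0-1 vectors with determinant ±1.
data Basis : Fin 2 → Fin 2 → Fin 2 → Fin 2 → Set where
  [10,01] : Basis 1F 0F 0F 1F
  [01,10] : Basis 0F 1F 1F 0F
  [10,11] : Basis 1F 0F 1F 1F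
  [11,10] : Basis 1F 1F 1F 0F
  [01,11] : Basis 0F 1F 1F 1F
  [11,01] : Basis 1F 1F 0F 1F

coprime-basis : ∀ {a b d₁ d₂ e₁ e₂} → Basis d₁ d₂ e₁ e₂ → Coprime a b →
                Coprime (d₁ · a + e₁ · b) (d₂ · a + e₂ · b)
coprime-basis {a} {b} [10,01] c = subst (λ x → Coprime x b) (sym (+-identityʳ a)) c
coprime-basis {a} {b} [01,10] c = subst (Coprime b) (sym (+-identityʳ a)) (coprime-sym c)
coprime-basis {a} {b} [10,11] c = subst (λ x → Coprime x b) (+-comm b a) (coprime-+ c)
coprime-basis {a} {b} [11,10] c = subst (Coprime (a + b)) (sym (+-identityʳ a)) (coprime-+ (coprime-sym c))
coprime-basis {a} {b} [01,11] c = coprime-sym (subst (λ x → Coprime x b) (+-comm b a) (coprime-+ c))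
coprime-basis {a} {b} [11,01] c =
  coprime-sym (subst (Coprime (a + b)) (sym (+-identityʳ a)) (coprime-+ (coprime-sym c)))

square-fixes-𝟙-or-constant-𝟘 : (g : Endo) → g (g 𝟙) ≡ 𝟙 ⊎ (∀ x → g x ≡ 𝟘)
square-fixes-𝟙-or-constant-𝟘 g with g 𝟙 in g𝟙 | g 𝟘 in g𝟘
... | 1F | _  = inj₁ g𝟙
... | 0F | 1F = inj₁ g𝟘
... | 0F | 0F = inj₂ λ where
  0F → g𝟘
  1F → g𝟙

^-even-fixes-𝟙 : (g : Endo) → g (g 𝟙) ≡ 𝟙 → ∀ n → (g ^ᶠ (n + n)) 𝟙 ≡ 𝟙
^-even-fixes-𝟙 g gg𝟙≡𝟙 zero = refl
^-even-fixes-𝟙 g gg𝟙≡𝟙 (suc n) rewrite +-suc n n | ^-even-fixes-𝟙 g gg𝟙≡𝟙 n = gg𝟙≡𝟙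

^-odd-sends-𝟙-to-𝟘 : (g : Endo) → g 𝟙 ≡ 𝟘 → ∀ n → (g ^ᶠ suc (n + n)) 𝟙 ≡ 𝟘
^-odd-sends-𝟙-to-𝟘 g g𝟙≡𝟘 n with square-fixes-𝟙-or-constant-𝟘 g
... | inj₁ gg𝟙≡𝟙 rewrite ^-even-fixes-𝟙 g gg𝟙≡𝟙 n = g𝟙≡𝟘
... | inj₂ g≡𝟘   = g≡𝟘 _

module _ {A : Set} where

  BlockPeriodic : (ℕ → ℕ → A) → (s₁ s₂ P : ℕ) → Set
  BlockPeriodic w s₁ s₂ P =
    ∀ y₁ y₂ z₁ z₂ → z₁ < s₁ → z₂ < s₂ → w (P * y₁ + z₁) (P * y₂ + z₂) ≡ w z₁ z₂

  SURD-if-block-periodic : {w : ℕ → ℕ → A} →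
    (∀ s₁ s₂ → ∃[ P ] 0 < P × BlockPeriodic w s₁ s₂ P) → SURD w
  SURD-if-block-periodic {w} periodic s₁ s₂ with periodic s₁ s₂
  ... | P , P>0 , period = P , λ q₁ q₂ _ m → returns q₁ q₂ (multiple-within P>0 m)
    where
    rearrange : ∀ z t P q → z + t * P * q ≡ P * (t * q) + z
    rearrange = solve-∀
    returns : ∀ q₁ q₂ {m} → ∃[ k ] k < P × ∃[ t ] m + k ≡ t * P →
              ∃[ k ] k < P × BlockEq (slice w s₁ s₂ q₁ q₂ (m + k)) (slice w s₁ s₂ q₁ q₂ 0)
    returns q₁ q₂ {m} (k , k<P , t , m+k≡tP) = k , k<P , λ i j → begin
      w (toℕ i + (m + k) * q₁) (toℕ j + (m + k) * q₂)
        ≡⟨ cong₂ w (reposition i q₁) (reposition j q₂) ⟩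
      w (P * (t * q₁) + toℕ i) (P * (t * q₂) + toℕ j)
        ≡⟨ period _ _ _ _ (toℕ<n i) (toℕ<n j) ⟩
      w (toℕ i) (toℕ j)
        ≡⟨ cong₂ w (+-identityʳ (toℕ i)) (+-identityʳ (toℕ j)) ⟨
      w (toℕ i + 0) (toℕ j + 0) ∎
      where
      open ≡-Reasoning
      reposition : ∀ {s} (i : Fin s) q → toℕ i + (m + k) * q ≡ P * (t * q) + toℕ i
      reposition i q = trans (cong (λ n → toℕ i + n * q) m+k≡tP) (rearrange (toℕ i) t P q)

  constant-block-periodic : ∀ {w : ℕ → ℕ → A} {c} → (∀ x y → w x y ≡ c) →
    ∀ s₁ s₂ P → BlockPeriodic w s₁ s₂ P
  constant-block-periodic constant s₁ s₂ P y₁ y₂ z₁ z₂ _ _ =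
    trans (constant _ _) (sym (constant z₁ z₂))

  ¬SURD-if-lines-avoid-origin : {w : ℕ → ℕ → A} →
    (∀ b → ∃[ q₁ ] ∃[ q₂ ] Coprime q₁ q₂ × (∀ k → k < b → w (suc k * q₁) (suc k * q₂) ≢ w 0 0)) →
    ¬ SURD w
  ¬SURD-if-lines-avoid-origin avoid surd with surd 1 1
  ... | b , recurrent with avoid b
  ... | q₁ , q₂ , coprime , avoids with recurrent q₁ q₂ coprime 1
  ... | k , k<b , same = avoids k k<b (same 0F 0F)

entry : SqMorphism2 A₂ → Fin 2 → Fin 2 → Endo
entry φ d₁ d₂ c = φ c d₁ d₂

module _ {A : Set} (φ : SqMorphism2 A) where

  iter-split : ∀ k n a y₁ y₂ z₁ z₂ → z₁ < 2 ^ k → z₂ < 2 ^ k →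
    iter φ (k + n) a (2 ^ k * y₁ + z₁) (2 ^ k * y₂ + z₂) ≡ iter φ k (iter φ n a y₁ y₂) z₁ z₂
  iter-split zero    n a y₁ y₂ .0 .0 (s≤s z≤n) (s≤s z≤n) =
    cong₂ (iter φ n a) (2^0*n+0≡n y₁) (2^0*n+0≡n y₂)
  iter-split (suc k) n a y₁ y₂ z₁ z₂ z₁< z₂<
    rewrite halve-2^[1+k]*n+m k z₁ y₁ | halve-2^[1+k]*n+m k z₂ y₂
          | mod2-2^[1+k]*n+m k z₁ y₁ | mod2-2^[1+k]*n+m k z₂ y₂ =
    cong (λ c → φ c (z₁ mod 2) (z₂ mod 2))
         (iter-split k n a y₁ y₂ (z₁ / 2) (z₂ / 2) (half-< {n = k} z₁<) (half-< {n = k} z₂<))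

  iter-top : ∀ n a z₁ z₂ → z₁ < 2 ^ n → z₂ < 2 ^ n →
    iter φ (suc n) a z₁ z₂ ≡ iter φ n (φ a 0F 0F) z₁ z₂
  iter-top n a z₁ z₂ z₁< z₂< =
    subst (λ m → iter φ m a z₁ z₂ ≡ top) (+-comm n 1)
      (subst₂ (λ x y → iter φ (n + 1) a x y ≡ top) (no-shift z₁) (no-shift z₂)
        (iter-split n 1 a 0 0 z₁ z₂ z₁< z₂<))
    where
    top = iter φ n (φ a 0F 0F) z₁ z₂
    no-shift : ∀ z → 2 ^ n * 0 + z ≡ z
    no-shift z = cong (_+ z) (*-zeroʳ (2 ^ n))

  iter-stable : ∀ {a} → Prolongable φ a → ∀ k n x y → x < 2 ^ n → y < 2 ^ n →
    iter φ (k + n) a x y ≡ iter φ n a x y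
  iter-stable prolongable zero    n x y x< y< = refl
  iter-stable {a} prolongable (suc k) n x y x< y< = begin
    iter φ (suc k + n) a x y          ≡⟨ iter-top (k + n) a x y (<-≤-trans x< 2^n≤) (<-≤-trans y< 2^n≤) ⟩
    iter φ (k + n) (φ a 0F 0F) x y    ≡⟨ cong (λ c → iter φ (k + n) c x y) prolongable ⟩
    iter φ (k + n) a x y              ≡⟨ iter-stable prolongable k n x y x< y< ⟩
    iter φ n a x y                    ∎
    where
    open ≡-Reasoning
    2^n≤ : 2 ^ n ≤ 2 ^ (k + n)
    2^n≤ = ^-monoʳ-≤ 2 (m≤n+m n k)

  fixedPoint≡iter : ∀ {a} → Prolongable φ a → ∀ M x y → x < 2 ^ M → y < 2 ^ M →
    fixedPoint φ a x y ≡ iter φ M a x y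
  fixedPoint≡iter {a} prolongable M x y x< y< = begin
    iter φ (suc (x + y)) a x y      ≡⟨ iter-stable prolongable M _ x y x<2^L y<2^L ⟨
    iter φ (M + suc (x + y)) a x y  ≡⟨ cong (λ m → iter φ m a x y) (+-comm M _) ⟩
    iter φ (suc (x + y) + M) a x y  ≡⟨ iter-stable prolongable (suc (x + y)) M x y x< y< ⟩
    iter φ M a x y                  ∎
    where
    open ≡-Reasoning
    x<2^L : x < 2 ^ suc (x + y)
    x<2^L = <-≤-trans (n<2^n x) (^-monoʳ-≤ 2 (m≤n⇒m≤1+n (m≤m+n x y)))
    y<2^L : y < 2 ^ suc (x + y)
    y<2^L = <-≤-trans (n<2^n y) (^-monoʳ-≤ 2 (m≤n⇒m≤1+n (m≤n+m y x)))

  fixedPoint-split : ∀ {a} → Prolongable φ a → ∀ M L x₁ x₂ y₁ y₂ →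
    x₁ < 2 ^ M → x₂ < 2 ^ M → y₁ < 2 ^ L → y₂ < 2 ^ L →
    fixedPoint φ a (2 ^ M * y₁ + x₁) (2 ^ M * y₂ + x₂) ≡ iter φ M (iter φ L a y₁ y₂) x₁ x₂
  fixedPoint-split prolongable M L x₁ x₂ y₁ y₂ x₁< x₂< y₁< y₂< =
    trans (fixedPoint≡iter prolongable (M + L) _ _ (bound x₁< y₁<) (bound x₂< y₂<))
          (iter-split M L _ y₁ y₂ x₁ x₂ x₁< x₂<)
    where
    bound : ∀ {x y} → x < 2 ^ M → y < 2 ^ L → 2 ^ M * y + x < 2 ^ (M + L)
    bound x< y< = subst (_ <_) (sym (^-distribˡ-+-* 2 M L)) (m*n+o<m*p y< x<)

  fixedPoint-block-periodic : ∀ {a} → Prolongable φ a → (∀ c → φ c 0F 0F ≡ a) →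
    ∀ s₁ s₂ → BlockPeriodic (fixedPoint φ a) s₁ s₂ (2 ^ suc (s₁ + s₂))
  fixedPoint-block-periodic {a} prolongable starts-with-a s₁ s₂ y₁ y₂ z₁ z₂ z₁<s₁ z₂<s₂ = begin
    fixedPoint φ a (2 ^ suc n * y₁ + z₁) (2 ^ suc n * y₂ + z₂)
      ≡⟨ fixedPoint-split prolongable (suc n) L z₁ z₂ y₁ y₂
           (lift z₁<2^n) (lift z₂<2^n) y₁<2^L y₂<2^L ⟩
    iter φ (suc n) (iter φ L a y₁ y₂) z₁ z₂
      ≡⟨ iter-top n _ z₁ z₂ z₁<2^n z₂<2^n ⟩
    iter φ n (φ (iter φ L a y₁ y₂) 0F 0F) z₁ z₂
      ≡⟨ cong (λ c → iter φ n c z₁ z₂) (starts-with-a _) ⟩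
    iter φ n a z₁ z₂
      ≡⟨ fixedPoint≡iter prolongable n z₁ z₂ z₁<2^n z₂<2^n ⟨
    fixedPoint φ a z₁ z₂ ∎
    where
    open ≡-Reasoning
    n = s₁ + s₂
    L = y₁ + y₂
    z₁<2^n : z₁ < 2 ^ n
    z₁<2^n = <-≤-trans z₁<s₁ (≤-trans (m≤m+n s₁ s₂) (<⇒≤ (n<2^n n)))
    z₂<2^n : z₂ < 2 ^ n
    z₂<2^n = <-≤-trans z₂<s₂ (≤-trans (m≤n+m s₂ s₁) (<⇒≤ (n<2^n n)))
    lift : ∀ {z} → z < 2 ^ n → z < 2 ^ suc n
    lift z< = <-≤-trans z< (^-monoʳ-≤ 2 (n≤1+n n))
    y₁<2^L : y₁ < 2 ^ L
    y₁<2^L = <-≤-trans (n<2^n y₁) (^-monoʳ-≤ 2 (m≤m+n y₁ y₂))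
    y₂<2^L : y₂ < 2 ^ L
    y₂<2^L = <-≤-trans (n<2^n y₂) (^-monoʳ-≤ 2 (m≤n+m y₂ y₁))

  fixedPoint-constant : ∀ {a} → (∀ i j → φ a i j ≡ a) → ∀ x y → fixedPoint φ a x y ≡ a
  fixedPoint-constant {a} constant x y = iter-constant (suc (x + y)) x y
    where
    iter-constant : ∀ n x y → iter φ n a x y ≡ a
    iter-constant zero    x y = refl
    iter-constant (suc n) x y rewrite iter-constant n (x / 2) (y / 2) = constant _ _

module Obstruction (φ : SqMorphism2 A₂) (fixes : ∀ a → φ a 0F 0F ≡ a) where

  entry-digit : ∀ d₁ d₂ x c →
    φ c ((d₁ · x) mod 2) ((d₂ · x) mod 2) ≡ (entry φ d₁ d₂ ^ᶠ toℕ (x mod 2)) c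
  entry-digit 0F 0F x c with x mod 2
  ... | 0F = fixes c
  ... | 1F = refl
  entry-digit 0F 1F x c with x mod 2
  ... | 0F = fixes c
  ... | 1F = refl
  entry-digit 1F 0F x c with x mod 2
  ... | 0F = fixes c
  ... | 1F = refl
  entry-digit 1F 1F x c with x mod 2
  ... | 0F = fixes c
  ... | 1F = refl

  iter-along : ∀ d₁ d₂ M a x → iter φ M a (d₁ · x) (d₂ · x) ≡ (entry φ d₁ d₂ ^ᶠ popCount M x) a
  iter-along d₁ d₂ zero    a x = refl
  iter-along d₁ d₂ (suc M) a x rewrite ·-halve d₁ x | ·-halve d₂ x | iter-along d₁ d₂ M a (x / 2) =
    trans (entry-digit d₁ d₂ x _) (sym (cong-app (^-homo (entry φ d₁ d₂) (toℕ (x mod 2)) _) a))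

  lineDirection : Fin 2 → Fin 2 → ℕ → ℕ → ℕ
  lineDirection d e N K = d · pred (2 ^ N) + e · (2 ^ (N + N) * pred (2 ^ K))

  fixedPoint-on-line : ∀ d₁ d₂ e₁ e₂ N K j → suc j ≤ 2 ^ N → suc j ≤ 2 ^ K →
    fixedPoint φ 𝟙 (suc j * lineDirection d₁ e₁ N K) (suc j * lineDirection d₂ e₂ N K)
      ≡ (entry φ d₁ d₂ ^ᶠ N) ((entry φ e₁ e₂ ^ᶠ K) 𝟙)
  fixedPoint-on-line d₁ d₂ e₁ e₂ N K j j<2^N j<2^K = begin
    fixedPoint φ 𝟙 (suc j * lineDirection d₁ e₁ N K) (suc j * lineDirection d₂ e₂ N K)
      ≡⟨ cong₂ (fixedPoint φ 𝟙) (line-position (suc j) d₁ e₁ X Z Y)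
                                (line-position (suc j) d₂ e₂ X Z Y) ⟩
    fixedPoint φ 𝟙 (2 ^ (N + N) * (e₁ · y) + d₁ · x) (2 ^ (N + N) * (e₂ · y) + d₂ · x)
      ≡⟨ fixedPoint-split φ (fixes 𝟙) (N + N) (K + K) _ _ _ _
           (·-< d₁ x<) (·-< d₂ x<) (·-< e₁ y<) (·-< e₂ y<) ⟩
    iter φ (N + N) (iter φ (K + K) 𝟙 (e₁ · y) (e₂ · y)) (d₁ · x) (d₂ · x)
      ≡⟨ cong (λ c → iter φ (N + N) c (d₁ · x) (d₂ · x)) (iter-along e₁ e₂ (K + K) 𝟙 y) ⟩
    iter φ (N + N) ((entry φ e₁ e₂ ^ᶠ popCount (K + K) y) 𝟙) (d₁ · x) (d₂ · x)
      ≡⟨ iter-along d₁ d₂ (N + N) _ x ⟩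
    (entry φ d₁ d₂ ^ᶠ popCount (N + N) x) ((entry φ e₁ e₂ ^ᶠ popCount (K + K) y) 𝟙)
      ≡⟨ cong₂ (λ n m → (entry φ d₁ d₂ ^ᶠ n) ((entry φ e₁ e₂ ^ᶠ m) 𝟙))
               (popCount-mersenne-multiple j N j<2^N) (popCount-mersenne-multiple j K j<2^K) ⟩
    (entry φ d₁ d₂ ^ᶠ N) ((entry φ e₁ e₂ ^ᶠ K) 𝟙) ∎
    where
    open ≡-Reasoning
    X = pred (2 ^ N)
    Y = pred (2 ^ K)
    Z = 2 ^ (N + N)
    x = suc j * X
    y = suc j * Y
    x< : x < 2 ^ (N + N)
    x< = mersenne-multiple-< j N j<2^N
    y< : y < 2 ^ (K + K)
    y< = mersenne-multiple-< j K j<2^K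
    ·-< : ∀ d {z n} → z < n → d · z < n
    ·-< d {z} z<n = ≤-<-trans (·-≤ d z) z<n

  ¬SURD-along : ∀ {d₁ d₂ e₁ e₂} → Basis d₁ d₂ e₁ e₂ →
    (∀ b → ∃[ N ] b ≤ N × (entry φ d₁ d₂ ^ᶠ N) ((entry φ e₁ e₂ ^ᶠ suc N) 𝟙) ≡ 𝟘) →
    ¬ SURD (fixedPoint φ 𝟙)
  ¬SURD-along {d₁} {d₂} {e₁} {e₂} basis often = ¬SURD-if-lines-avoid-origin {w = fixedPoint φ 𝟙} avoid
    where
    avoid : ∀ b → ∃[ q₁ ] ∃[ q₂ ] Coprime q₁ q₂ ×
            (∀ k → k < b → fixedPoint φ 𝟙 (suc k * q₁) (suc k * q₂) ≢ fixedPoint φ 𝟙 0 0)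
    avoid b with often b
    ... | N , b≤N , value≡𝟘 = q₁ , q₂ , coprime-basis basis (mersenne-coprime N) , λ k k<b same →
      0F≢1+i (begin
        𝟘                                                    ≡⟨ value≡𝟘 ⟨
        (entry φ d₁ d₂ ^ᶠ N) ((entry φ e₁ e₂ ^ᶠ suc N) 𝟙)  ≡⟨ on-line k k<b ⟨
        fixedPoint φ 𝟙 (suc k * q₁) (suc k * q₂)             ≡⟨ same ⟩
        φ 𝟙 0F 0F                                            ≡⟨ fixes 𝟙 ⟩
        𝟙                                                    ∎)
      where
      open ≡-Reasoning
      q₁ = lineDirection d₁ e₁ N (suc N)
      q₂ = lineDirection d₂ e₂ N (suc N)
      on-line : ∀ k → k < b →
        fixedPoint φ 𝟙 (suc k * q₁) (suc k * q₂) ≡ (entry φ d₁ d₂ ^ᶠ N) ((entry φ e₁ e₂ ^ᶠ suc N) 𝟙)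
      on-line k k<b =
        fixedPoint-on-line d₁ d₂ e₁ e₂ N (suc N) k k<2^N (≤-trans k<2^N (^-monoʳ-≤ 2 (n≤1+n N)))
        where
        k<2^N : k < 2 ^ N
        k<2^N = <-≤-trans k<b (≤-trans b≤N (<⇒≤ (n<2^n N)))

  ¬SURD-if-entry-𝟘-of-basis : ∀ {d₁ d₂ e₁ e₂} → Basis d₁ d₂ e₁ e₂ → Basis e₁ e₂ d₁ d₂ →
    φ 𝟙 d₁ d₂ ≡ 𝟘 → ¬ SURD (fixedPoint φ 𝟙)
  ¬SURD-if-entry-𝟘-of-basis {d₁} {d₂} {e₁} {e₂} de ed φ𝟙d≡𝟘
    with square-fixes-𝟙-or-constant-𝟘 (entry φ e₁ e₂)
  ... | inj₁ gₑgₑ𝟙≡𝟙 = ¬SURD-along de λ b →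
    suc (b + b) , m≤n⇒m≤1+n (m≤m+n b b) ,
    trans (cong (entry φ d₁ d₂ ^ᶠ suc (b + b)) (even-fixes-𝟙 b))
          (^-odd-sends-𝟙-to-𝟘 (entry φ d₁ d₂) φ𝟙d≡𝟘 b)
    where
    even-fixes-𝟙 : ∀ b → (entry φ e₁ e₂ ^ᶠ suc (suc (b + b))) 𝟙 ≡ 𝟙
    even-fixes-𝟙 b = subst (λ n → (entry φ e₁ e₂ ^ᶠ n) 𝟙 ≡ 𝟙) (+-suc (suc b) b)
                           (^-even-fixes-𝟙 (entry φ e₁ e₂) gₑgₑ𝟙≡𝟙 (suc b))
  ... | inj₂ gₑ≡𝟘 = ¬SURD-along ed λ b → suc b , n≤1+n b , gₑ≡𝟘 _

  ¬SURD-if-entry-𝟘 : ∀ d₁ d₂ → φ 𝟙 d₁ d₂ ≡ 𝟘 → ¬ SURD (fixedPoint φ 𝟙)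
  ¬SURD-if-entry-𝟘 0F 0F φ𝟙₀₀≡𝟘 = ⊥-elim (0F≢1+i (trans (sym φ𝟙₀₀≡𝟘) (fixes 𝟙)))
  ¬SURD-if-entry-𝟘 1F 0F = ¬SURD-if-entry-𝟘-of-basis [10,01] [01,10]
  ¬SURD-if-entry-𝟘 0F 1F = ¬SURD-if-entry-𝟘-of-basis [01,10] [10,01]
  ¬SURD-if-entry-𝟘 1F 1F = ¬SURD-if-entry-𝟘-of-basis [11,10] [10,11]

theorem6p20 : (φ : SqMorphism2 A₂) → Prolongable φ 𝟙 →
    (SURD (fixedPoint φ 𝟙) ⇔ (φ 𝟘 Data.Fin.zero Data.Fin.zero ≡ 𝟙 ⊎ (∀ (i j : Fin 2) → φ 𝟙 i j ≡ 𝟙)))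
theorem6p20 φ prolongable = mk⇔ only-if if
  where
  if : φ 𝟘 0F 0F ≡ 𝟙 ⊎ (∀ i j → φ 𝟙 i j ≡ 𝟙) → SURD (fixedPoint φ 𝟙)
  if (inj₁ φ𝟘₀₀≡𝟙) = SURD-if-block-periodic {w = fixedPoint φ 𝟙} λ s₁ s₂ →
    2 ^ suc (s₁ + s₂) , m^n>0 2 (suc (s₁ + s₂)) ,
    fixedPoint-block-periodic φ prolongable starts-with-𝟙 s₁ s₂
    where
    starts-with-𝟙 : ∀ c → φ c 0F 0F ≡ 𝟙
    starts-with-𝟙 0F = φ𝟘₀₀≡𝟙
    starts-with-𝟙 1F = prolongable
  if (inj₂ φ𝟙≡𝟙) = SURD-if-block-periodic λ s₁ s₂ →
    1 , s≤s z≤n , constant-block-periodic (fixedPoint-constant φ φ𝟙≡𝟙) s₁ s₂ 1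
  only-if : SURD (fixedPoint φ 𝟙) → φ 𝟘 0F 0F ≡ 𝟙 ⊎ (∀ i j → φ 𝟙 i j ≡ 𝟙)
  only-if surd with φ 𝟘 0F 0F in φ𝟘₀₀
  ... | 1F = inj₁ refl
  ... | 0F = inj₂ entry-𝟙
    where
    fixes : ∀ c → φ c 0F 0F ≡ c
    fixes 0F = φ𝟘₀₀
    fixes 1F = prolongable
    entry-𝟙 : ∀ i j → φ 𝟙 i j ≡ 𝟙
    entry-𝟙 i j with φ 𝟙 i j in φ𝟙ij
    ... | 1F = refl
    ... | 0F = ⊥-elim (Obstruction.¬SURD-if-entry-𝟘 φ fixes i j φ𝟙ij surd)
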